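{- There is an optimal schedule $S$ (a feasible schedule of all jobs minimizing the energy $E$) with the following property: for any small gap $[u,t)$ of $S$ and any job $j$, if $C_j(S)\ge t$ then $r_j\ge t$.
   Context: Time is discrete, divided into unit slots $[t,t+1)$ (slot $t$). There are $n$ jobs; job $j$ has integer release time $r_j$, deadline $d_j$ and positive integer processing time $p_j$; $L>0$ is given. A feasible preemptive schedule on one processor assigns to each job $j$ exactly $p_j$ slots in $[r_j,d_j)$, at most one job per slot; $C_j(S)$ is the completion time of $j$. Standing assumptions: deadlines pairwise distinct, release times pairwise distinct, the instance is feasible, and schedules have the earliest-deadline property (at each slot, $S$ is idle or executes, among released, uncompleted jobs, the one with smallest deadline). A gap is a maximal finite interval of idle slots (the infinite idle intervals before the first and after the last busy slot are excluded). The energy is $E(S)=\sum_{\text{gaps }G}\min\{|G|,L\}$. A gap is small if its length is at most $L$. -}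

module Defs where

open import Data.Nat using (ℕ; zero; suc; _+_; _∸_; _≤_; _<_; _⊔_; _⊓_; _<ᵇ_)
open import Data.Fin using (Fin; _≟_)
import Data.Fin as Fin
open import Data.Bool using (Bool; true; false; _∧_; if_then_else_; T)
open import Data.Maybe using (Maybe; just; nothing)
open import Data.Product using (_×_; Σ; ∃)
open import Relation.Nullary.Decidable using (⌊_⌋)
open import Relation.Binary.PropositionalEquality using (_≡_)

record Instance (n : ℕ) : Set where
  field
    r : Fin n → ℕ
    d : Fin n → ℕ
    p : Fin n → ℕ
    L : ℕ
open Instance public

-- A schedule: slot t = [t,t+1) is idle (nothing) or runs one job (just j).
Schedule : ℕ → Set
Schedule n = ℕ → Maybe (Fin n)

sumBelow : ℕ → (ℕ → ℕ) → ℕ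
sumBelow zero    f = 0
sumBelow (suc a) f = sumBelow a f + f a

maxBelow : ℕ → (ℕ → ℕ) → ℕ
maxBelow zero    f = 0
maxBelow (suc a) f = maxBelow a f ⊔ f a

maxJobs : ∀ {n} → (Fin n → ℕ) → ℕ
maxJobs {zero}  f = 0
maxJobs {suc n} f = f Fin.zero ⊔ maxJobs (λ i → f (Fin.suc i))

runs : ∀ {n} → Schedule n → ℕ → Fin n → Bool
runs S t j with S t
... | nothing = false
... | just k  = ⌊ k ≟ j ⌋

busy : ∀ {n} → Schedule n → ℕ → Bool
busy S t with S t
... | nothing = false
... | just _  = true

work : ∀ {n} → Schedule n → Fin n → ℕ → ℕ
work S j a = sumBelow a (λ t → if runs S t j then 1 else 0)

-- feasibility: every slot used by j lies in [r_j, d_j), and j gets exactly p_j slots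
-- (all its slots lie before d_j, so counting slots in [0,d_j) counts all of them)
Feasible : ∀ {n} → Instance n → Schedule n → Set
Feasible I S =
  (∀ j t → runs S t j ≡ true → r I j ≤ t × t < d I j) ×
  (∀ j → work S j (d I j) ≡ p I j)

EDF : ∀ {n} → Instance n → Schedule n → Set
EDF I S = ∀ t j k → S t ≡ just j → r I k ≤ t → work S k t < p I k → d I j ≤ d I k

-- horizon: no feasible schedule is busy at or after the largest deadline
horizon : ∀ {n} → Instance n → ℕ
horizon I = maxJobs (d I)

idleRun : ∀ {n} → Schedule n → ℕ → ℕ → Bool
idleRun S u zero    = true
idleRun S u (suc k) = if busy S u then false else idleRun S (suc u) k

-- [u,t) is a gap: u < t, all slots in [u,t) idle, and the slots u-1 and t busy
-- (so it is a maximal finite idle interval)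
gapB : ∀ {n} → Schedule n → ℕ → ℕ → Bool
gapB S zero    t = false
gapB S (suc v) t = (suc v <ᵇ t) ∧ idleRun S (suc v) (t ∸ suc v) ∧ busy S v ∧ busy S t

Gap : ∀ {n} → Schedule n → ℕ → ℕ → Set
Gap S u t = T (gapB S u t)

SmallGap : ∀ {n} → Instance n → Schedule n → ℕ → ℕ → Set
SmallGap I S u t = Gap S u t × t ∸ u ≤ L I

-- energy E(S) = Σ_{gaps [u,t)} min(t - u, L); every gap of a feasible schedule ends
-- at a busy slot t < horizon
energy : ∀ {n} → Instance n → Schedule n → ℕ
energy I S = sumBelow (horizon I) (λ t → sumBelow t (λ u →
  if gapB S u t then (t ∸ u) ⊓ L I else 0))

completion : ∀ {n} → Instance n → Schedule n → Fin n → ℕ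
completion I S j = maxBelow (horizon I) (λ t → if runs S t j then suc t else 0)

-- optimal schedule: feasible (with the EDF property, a standing assumption) and of
-- minimum energy among all such schedules
Optimal : ∀ {n} → Instance n → Schedule n → Set
Optimal I S = Feasible I S × EDF I S ×
  (∀ S' → Feasible I S' → EDF I S' → energy I S ≤ energy I S')

-- Take an optimal schedule that, among optimal schedules, minimises the sum of its busy
-- slots.  Its energy is the number of charged slots: idle slots among the first L slots of
-- a gap.  Suppose a small gap [u,t) ends while a job j with r_j < t is unfinished.  Then
-- the pending job k of earliest deadline runs in some slot s ≥ t, and moving that unit of
-- k to slot t - 1 keeps the schedule feasible and EDF.  Slot t - 1 was charged (the gap is
-- small) and only slot s can become charged, so the energy does not grow, while the sum of
-- busy slots drops: a contradiction.
module Submission where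

open import Defs
open import Data.Nat
open import Data.Nat.Properties
open import Data.Fin using (Fin) renaming (_≟_ to _≟ᶠ_)
import Data.Fin as Fin
open import Data.Fin.Properties using (all?)
open import Data.Product using (Σ; ∃; _×_; _,_; proj₁; proj₂)
open import Data.Sum using (_⊎_; inj₁; inj₂)
open import Data.Empty using (⊥-elim)
open import Data.Bool using (true; false; if_then_else_; T; _∧_) renaming (_≟_ to _≟ᵇ_)
open import Data.Bool.Properties using (T-≡; ∧-conicalˡ; ∧-conicalʳ; ¬-not)
open import Data.Maybe using (Maybe; just; nothing)
open import Data.Maybe.Properties using (just-injective; ≡-dec)
open import Data.List using (List; []; _∷_; map; concatMap; allFin; filter)
open import Data.List.Membership.Propositional using (_∈_; lose)
open import Data.List.Membership.Propositional.Properties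
  using (∈-map⁺; ∈-concatMap⁺; ∈-allFin; ∈-filter⁺)
open import Data.List.Relation.Unary.All using (lookup)
open import Data.List.Relation.Unary.All.Properties using (all-filter)
open import Data.List.Relation.Unary.Any using (here; there)
open import Data.List.Extrema ≤-totalOrder using (argmin; argmin-all; f[argmin]≤f[xs])
open import Algebra.Properties.CommutativeSemigroup +-commutativeSemigroup using (interchange)
open import Function using (_∘_; case_of_)
open import Function.Bundles using (Equivalence)
open import Relation.Binary.Definitions using (tri<; tri≈; tri>)
open import Relation.Binary.PropositionalEquality
open import Relation.Nullary
open import Relation.Nullary.Decidable
  using (⌊_⌋; _×-dec_; _→-dec_; map′; isYes≗does; dec-true; dec-false)
open import Relation.Unary using (Decidable)

private
  variable
    A B : Set
    n : ℕ
    S S' : Schedule n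
    I : Instance n
    j k : Fin n

sumBelow-cong : ∀ k {f g : ℕ → ℕ} → (∀ {x} → x < k → f x ≡ g x) → sumBelow k f ≡ sumBelow k g
sumBelow-cong zero    f≡g = refl
sumBelow-cong (suc k) f≡g = cong₂ _+_ (sumBelow-cong k (λ x<k → f≡g (m≤n⇒m≤1+n x<k))) (f≡g ≤-refl)

sumBelow-mono : ∀ k {f g : ℕ → ℕ} → (∀ {x} → x < k → f x ≤ g x) → sumBelow k f ≤ sumBelow k g
sumBelow-mono zero    f≤g = z≤n
sumBelow-mono (suc k) f≤g = +-mono-≤ (sumBelow-mono k (λ x<k → f≤g (m≤n⇒m≤1+n x<k))) (f≤g ≤-refl)

sumBelow-zero : ∀ k {f : ℕ → ℕ} → (∀ {x} → x < k → f x ≡ 0) → sumBelow k f ≡ 0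
sumBelow-zero zero    f≡0 = refl
sumBelow-zero (suc k) f≡0 = cong₂ _+_ (sumBelow-zero k (λ x<k → f≡0 (m≤n⇒m≤1+n x<k))) (f≡0 ≤-refl)

sumBelow-+ : ∀ k (f g : ℕ → ℕ) → sumBelow k (λ x → f x + g x) ≡ sumBelow k f + sumBelow k g
sumBelow-+ zero    f g = refl
sumBelow-+ (suc k) f g = begin
  sumBelow k (λ x → f x + g x) + (f k + g k) ≡⟨ cong (_+ (f k + g k)) (sumBelow-+ k f g) ⟩
  sumBelow k f + sumBelow k g + (f k + g k)  ≡⟨ interchange (sumBelow k f) (sumBelow k g) (f k) (g k) ⟩
  sumBelow k f + f k + (sumBelow k g + g k)  ∎
  where open ≡-Reasoning

sumBelow-single : ∀ k (f : ℕ → ℕ) {c} → c < k → (∀ {x} → x < k → x ≢ c → f x ≡ 0) →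
                  sumBelow k f ≡ f c
sumBelow-single (suc k) f {c} c<1+k f≡0 with m≤n⇒m<n∨m≡n (s≤s⁻¹ c<1+k)
... | inj₁ c<k = begin
  sumBelow k f + f k ≡⟨ cong₂ _+_ (sumBelow-single k f c<k (λ x<k → f≡0 (m≤n⇒m≤1+n x<k)))
                                  (f≡0 ≤-refl (≢-sym (<⇒≢ c<k))) ⟩
  f c + 0            ≡⟨ +-identityʳ (f c) ⟩
  f c                ∎
  where open ≡-Reasoning
... | inj₂ refl = cong (_+ f k) (sumBelow-zero k (λ x<k → f≡0 (m≤n⇒m≤1+n x<k) (<⇒≢ x<k)))

⌊⌋-true : (a? : Dec A) → A → ⌊ a? ⌋ ≡ true
⌊⌋-true a? a = trans (isYes≗does a?) (dec-true a? a)

⌊⌋-false : (a? : Dec A) → ¬ A → ⌊ a? ⌋ ≡ false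
⌊⌋-false a? ¬a = trans (isYes≗does a?) (dec-false a? ¬a)

δ : ℕ → ℕ → ℕ → ℕ
δ c m x = if ⌊ x ≟ c ⌋ then m else 0

δ-at : ∀ c m → δ c m c ≡ m
δ-at c m rewrite ⌊⌋-true (c ≟ c) refl = refl

δ-off : ∀ {c x} m → x ≢ c → δ c m x ≡ 0
δ-off {c} {x} m x≢c rewrite ⌊⌋-false (x ≟ c) x≢c = refl

sumBelow-δ : ∀ {k c} m → c < k → sumBelow k (δ c m) ≡ m
sumBelow-δ {k} {c} m c<k = trans (sumBelow-single k (δ c m) c<k (λ _ → δ-off m)) (δ-at c m)

sumBelow-exchange : ∀ k {f g : ℕ → ℕ} {a s m₁ m₂} → a < k → s < k →
                    (∀ {x} → x < k → f x + δ a m₁ x ≤ g x + δ s m₂ x) →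
                    sumBelow k f + m₁ ≤ sumBelow k g + m₂
sumBelow-exchange k {f} {g} {a} {s} {m₁} {m₂} a<k s<k f≤g = begin
  sumBelow k f + m₁                     ≡⟨ cong (sumBelow k f +_) (sumBelow-δ m₁ a<k) ⟨
  sumBelow k f + sumBelow k (δ a m₁)    ≡⟨ sumBelow-+ k f (δ a m₁) ⟨
  sumBelow k (λ x → f x + δ a m₁ x)     ≤⟨ sumBelow-mono k f≤g ⟩
  sumBelow k (λ x → g x + δ s m₂ x)     ≡⟨ sumBelow-+ k g (δ s m₂) ⟩
  sumBelow k g + sumBelow k (δ s m₂)    ≡⟨ cong (sumBelow k g +_) (sumBelow-δ m₂ s<k) ⟩
  sumBelow k g + m₂                     ∎
  where open ≤-Reasoning

sumBelow-triangle : ∀ k (h : ℕ → ℕ → ℕ) →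
  sumBelow k (λ t → sumBelow t (λ x → h x t)) ≡
  sumBelow k (λ x → sumBelow k (λ t → if ⌊ x <? t ⌋ then h x t else 0))
sumBelow-triangle zero    h = refl
sumBelow-triangle (suc k) h = begin
  sumBelow k (λ t → sumBelow t (λ x → h x t)) + sumBelow k (λ x → h x k)
    ≡⟨ cong₂ _+_ (sumBelow-triangle k h) (sumBelow-cong k (λ x<k → sym (below-k x<k))) ⟩
  sumBelow k (λ x → sumBelow k (h< x)) + sumBelow k (λ x → h< x k)
    ≡⟨ sumBelow-+ k _ _ ⟨
  sumBelow k (λ x → sumBelow (suc k) (h< x))
    ≡⟨ +-identityʳ _ ⟨
  sumBelow k (λ x → sumBelow (suc k) (h< x)) + 0
    ≡⟨ cong (sumBelow k (λ x → sumBelow (suc k) (h< x)) +_) (sumBelow-zero (suc k) k-vanishes) ⟨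
  sumBelow k (λ x → sumBelow (suc k) (h< x)) + sumBelow (suc k) (h< k) ∎
  where
  open ≡-Reasoning
  h< : ℕ → ℕ → ℕ
  h< x t = if ⌊ x <? t ⌋ then h x t else 0
  below-k : ∀ {x} → x < k → h< x k ≡ h x k
  below-k x<k rewrite ⌊⌋-true (_ <? k) x<k = refl
  k-vanishes : ∀ {t} → t < suc k → h< k t ≡ 0
  k-vanishes t<1+k rewrite ⌊⌋-false (k <? _) (≤⇒≯ (s≤s⁻¹ t<1+k)) = refl

indicator : Dec A → ℕ
indicator (yes _) = 1
indicator (no _)  = 0

indicator-yes : (a? : Dec A) → A → indicator a? ≡ 1
indicator-yes (yes _) _ = refl
indicator-yes (no ¬a) a = contradiction a ¬a

indicator-no : (a? : Dec A) → ¬ A → indicator a? ≡ 0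
indicator-no (yes a) ¬a = contradiction a ¬a
indicator-no (no _)  _  = refl

indicator-≤1 : (a? : Dec A) → indicator a? ≤ 1
indicator-≤1 (yes _) = ≤-refl
indicator-≤1 (no _)  = z≤n

indicator-mono : (A → B) → (a? : Dec A) (b? : Dec B) → indicator a? ≤ indicator b?
indicator-mono A⇒B (yes a) b?      = ≤-reflexive (sym (indicator-yes b? (A⇒B a)))
indicator-mono A⇒B (no _)  b?      = z≤n

indicator-cong : (A → B) → (B → A) → (a? : Dec A) (b? : Dec B) → indicator a? ≡ indicator b?
indicator-cong A⇒B B⇒A a? b? = ≤-antisym (indicator-mono A⇒B a? b?) (indicator-mono B⇒A b? a?)

sumBelow-interval : ∀ k lo hi →
  sumBelow k (λ x → indicator ((lo ≤? x) ×-dec (x <? hi))) ≡ k ⊓ hi ∸ lo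
sumBelow-interval zero    lo hi = sym (0∸n≡0 lo)
sumBelow-interval (suc k) lo hi rewrite sumBelow-interval k lo hi with lo ≤? k | k <? hi
... | yes lo≤k | yes k<hi = begin
  k ⊓ hi ∸ lo + 1    ≡⟨ cong (λ m → m ∸ lo + 1) (m≤n⇒m⊓n≡m (<⇒≤ k<hi)) ⟩
  k ∸ lo + 1         ≡⟨ +-comm (k ∸ lo) 1 ⟩
  suc (k ∸ lo)       ≡⟨ +-∸-assoc 1 lo≤k ⟨
  suc k ∸ lo         ≡⟨ cong (_∸ lo) (m≤n⇒m⊓n≡m k<hi) ⟨
  suc k ⊓ hi ∸ lo    ∎
  where open ≡-Reasoning
... | yes _ | no k≮hi = trans (+-identityʳ _)
      (cong (_∸ lo) (trans (m≥n⇒m⊓n≡n (≮⇒≥ k≮hi))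
                           (sym (m≥n⇒m⊓n≡n (m≤n⇒m≤1+n (≮⇒≥ k≮hi))))))
... | no lo≰k | _ = trans (+-identityʳ _)
      (trans (m≤n⇒m∸n≡0 (≤-trans (m⊓n≤m k hi) (<⇒≤ (≰⇒> lo≰k))))
             (sym (m≤n⇒m∸n≡0 (≤-trans (m⊓n≤m (suc k) hi) (≰⇒> lo≰k)))))

Idle Busy : Schedule n → ℕ → Set
Idle S x = busy S x ≡ false
Busy S x = busy S x ≡ true

false≢true : false ≢ true
false≢true ()

runs-cong : ∀ (S S' : Schedule n) {t t' j} → S t ≡ S' t' → runs S t j ≡ runs S' t' j
runs-cong S S' {t} {t'} eq with S t | S' t' | eq
... | m | .m | refl = refl

busy-cong : ∀ (S S' : Schedule n) {t t'} → S t ≡ S' t' → busy S t ≡ busy S' t'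
busy-cong S S' {t} {t'} eq with S t | S' t' | eq
... | m | .m | refl = refl

module _ (S : Schedule n) {t : ℕ} where

  idle⇒¬busy : Idle S t → ¬ Busy S t
  idle⇒¬busy idle busy' = false≢true (trans (sym idle) busy')

  just⇒runs : S t ≡ just j → runs S t j ≡ true
  just⇒runs {j} eq with S t | eq
  ... | .(just j) | refl = ⌊⌋-true (j ≟ᶠ j) refl

  just⇒¬runs : S t ≡ just k → k ≢ j → runs S t j ≡ false
  just⇒¬runs {k} {j} eq k≢j with S t | eq
  ... | .(just k) | refl = ⌊⌋-false (k ≟ᶠ j) k≢j

  runs⇒just : runs S t j ≡ true → S t ≡ just j
  runs⇒just {j} run with S t | run
  ... | nothing | ()
  ... | just k  | run' with k ≟ᶠ j | run'
  ...   | yes refl | _ = refl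
  ...   | no _     | ()

  just⇒busy : S t ≡ just j → Busy S t
  just⇒busy eq with S t | eq
  ... | _ | refl = refl

  nothing⇒idle : S t ≡ nothing → Idle S t
  nothing⇒idle eq with S t | eq
  ... | _ | refl = refl

  nothing⇒¬runs : S t ≡ nothing → runs S t j ≡ false
  nothing⇒¬runs eq with S t | eq
  ... | _ | refl = refl

  runs⇒busy : runs S t j ≡ true → Busy S t
  runs⇒busy run = just⇒busy (runs⇒just run)

  idle⇒¬runs : Idle S t → runs S t j ≡ false
  idle⇒¬runs {j} idle with runs S t j in run
  ... | true  = contradiction (runs⇒busy run) (idle⇒¬busy idle)
  ... | false = refl

IdleBetween : Schedule n → ℕ → ℕ → Set
IdleBetween S x t = ∀ {y} → y < t → x < y → Idle S y

idleBetween-join : ∀ {v x t} → IdleBetween S v x → Idle S x → IdleBetween S x t → IdleBetween S v t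
idleBetween-join {x = x} left mid right {y} y<t v<y with <-cmp y x
... | tri< y<x _ _ = left y<x v<y
... | tri≈ _ refl _ = mid
... | tri> _ _ x<y = right y<t x<y

lastBusyBelow : ∀ (S : Schedule n) x →
  (∀ {y} → y < x → Idle S y) ⊎ (∃ λ v → v < x × Busy S v × IdleBetween S v x)
lastBusyBelow S zero = inj₁ λ ()
lastBusyBelow S (suc x) with busy S x in b | lastBusyBelow S x
... | true  | _ = inj₂ (x , ≤-refl , b , λ y<1+x x<y → contradiction (s≤s⁻¹ y<1+x) (<⇒≱ x<y))
... | false | inj₁ idle = inj₁ λ y<1+x → case m≤n⇒m<n∨m≡n (s≤s⁻¹ y<1+x) of λ where
  (inj₁ y<x)  → idle y<x
  (inj₂ refl) → b
... | false | inj₂ (v , v<x , busy-v , idle) =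
  inj₂ (v , m≤n⇒m≤1+n v<x , busy-v ,
        idleBetween-join idle b λ y<1+x x<y → contradiction (s≤s⁻¹ y<1+x) (<⇒≱ x<y))

firstBusyAbove : ∀ (S : Schedule n) x k →
  IdleBetween S x k ⊎ (∃ λ t → t < k × x < t × Busy S t × IdleBetween S x t)
firstBusyAbove S x zero = inj₁ λ ()
firstBusyAbove S x (suc k) with firstBusyAbove S x k
... | inj₂ (t , t<k , x<t , busy-t , idle) = inj₂ (t , m≤n⇒m≤1+n t<k , x<t , busy-t , idle)
... | inj₁ idle with x <? k | busy S k in b
...   | yes x<k | true  = inj₂ (k , ≤-refl , x<k , b , idle)
...   | yes x<k | false =
  inj₁ (idleBetween-join idle b λ y<1+k k<y → contradiction (s≤s⁻¹ y<1+k) (<⇒≱ k<y))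
...   | no x≮k  | _     = inj₁ λ y<1+k x<y → case m≤n⇒m<n∨m≡n (s≤s⁻¹ y<1+k) of λ where
  (inj₁ y<k)  → idle y<k x<y
  (inj₂ refl) → contradiction x<y x≮k

idleRun⇒idle : ∀ u m → idleRun S u m ≡ true → ∀ {y} → u ≤ y → y < u + m → Idle S y
idleRun⇒idle u zero _ u≤y y<u+0 = contradiction u≤y (<⇒≱ (subst (_ <_) (+-identityʳ u) y<u+0))
idleRun⇒idle {S = S} u (suc m) run u≤y y<u+1+m with busy S u in b | m≤n⇒m<n∨m≡n u≤y
... | true  | _          = ⊥-elim (false≢true run)
... | false | inj₂ refl  = b
... | false | inj₁ u<y   = idleRun⇒idle (suc u) m run u<y (≤-trans y<u+1+m (≤-reflexive (+-suc u m)))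

idle⇒idleRun : ∀ u m → (∀ {y} → u ≤ y → y < u + m → Idle S y) → idleRun S u m ≡ true
idle⇒idleRun u zero    _    = refl
idle⇒idleRun {S = S} u (suc m) idle rewrite idle ≤-refl (≤-trans (m<m+n u z<s) ≤-refl) =
  idle⇒idleRun (suc u) m λ u<y y<1+u+m → idle (<⇒≤ u<y) (≤-trans y<1+u+m (≤-reflexive (sym (+-suc u m))))

-- the gap [suc v, t), indexed by the busy slot v before it
record GapBounds (S : Schedule n) (v t : ℕ) : Set where
  field
    nonempty   : suc v < t
    idle       : IdleBetween S v t
    busy-start : Busy S v
    busy-end   : Busy S t

gap⇒bounds : ∀ {u t} → gapB S u t ≡ true → ∃ λ v → u ≡ suc v × GapBounds S v t
gap⇒bounds {u = zero} ()
gap⇒bounds {S = S} {u = suc v} {t} gap = v , refl , record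
  { nonempty   = v<t
  ; idle       = λ y<t v<y → idleRun⇒idle (suc v) (t ∸ suc v) run v<y
                                (≤-trans y<t (≤-reflexive (sym (m+[n∸m]≡n (<⇒≤ v<t)))))
  ; busy-start = ∧-conicalˡ _ _ busy-ends
  ; busy-end   = ∧-conicalʳ _ _ busy-ends
  }
  where
  v<t : suc v < t
  v<t = <ᵇ⇒< (suc v) t (subst T (sym (∧-conicalˡ (suc v <ᵇ t) _ gap)) _)
  rest = ∧-conicalʳ (suc v <ᵇ t) _ gap
  run : idleRun S (suc v) (t ∸ suc v) ≡ true
  run = ∧-conicalˡ (idleRun S (suc v) (t ∸ suc v)) _ rest
  busy-ends : (busy S v ∧ busy S t) ≡ true
  busy-ends = ∧-conicalʳ (idleRun S (suc v) (t ∸ suc v)) _ rest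

bounds⇒gap : ∀ {v t} → GapBounds S v t → gapB S (suc v) t ≡ true
bounds⇒gap {S = S} {v} {t} record { nonempty = v<t ; idle = idle ; busy-start = bv ; busy-end = bt }
  rewrite Equivalence.to T-≡ (<⇒<ᵇ v<t)
        | idle⇒idleRun {S = S} (suc v) (t ∸ suc v)
            (λ v<y y<end → idle (≤-trans y<end (≤-reflexive (m+[n∸m]≡n (<⇒≤ v<t)))) v<y)
        | bv | bt = refl

gap-unique : ∀ {v v' t} → GapBounds S v t → GapBounds S v' t → v ≡ v'
gap-unique {S = S} {v = v} {v'} g g' with <-cmp v v'
... | tri< v<v' _ _ = contradiction (GapBounds.busy-start g')
                        (idle⇒¬busy S (GapBounds.idle g (<-trans (n<1+n v') (GapBounds.nonempty g')) v<v'))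
... | tri≈ _ eq _   = eq
... | tri> _ _ v'<v = contradiction (GapBounds.busy-start g)
                        (idle⇒¬busy S (GapBounds.idle g' (<-trans (n<1+n v) (GapBounds.nonempty g)) v'<v))

-- Energy counts charged slots

module _ (S : Schedule n) (L : ℕ) where

  BusyWithin : ℕ → Set
  BusyWithin x = ∃ λ y → y < x × (x ≤ y + L × Busy S y)

  busyWithin? : Decidable BusyWithin
  busyWithin? x = anyUpTo? (λ y → (x ≤? y + L) ×-dec (busy S y ≟ᵇ true)) x

  -- x is one of the first L slots of the gap ending at t
  GapCharged : ℕ → ℕ → Set
  GapCharged x t = Idle S x × Busy S t × IdleBetween S x t × BusyWithin x

  gapCharged? : ∀ x t → Dec (GapCharged x t)
  gapCharged? x t = (busy S x ≟ᵇ false) ×-dec (busy S t ≟ᵇ true) ×-dec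
                    allUpTo? (λ y → (x <? y) →-dec (busy S y ≟ᵇ false)) t ×-dec busyWithin? x

  Charged : ℕ → ℕ → Set
  Charged H x = Idle S x × BusyWithin x × ∃ λ y → y < H × (x < y × Busy S y)

  charged? : ∀ H x → Dec (Charged H x)
  charged? H x = (busy S x ≟ᵇ false) ×-dec busyWithin? x ×-dec
                 anyUpTo? (λ y → (x <? y) ×-dec (busy S y ≟ᵇ true)) H

  gapCharged⇒gap : ∀ {x t} → x < t → GapCharged x t → ∃ λ v → GapBounds S v t × suc v ≤ x
  gapCharged⇒gap {x} x<t (idle-x , busy-t , idle-xt , w , w<x , _ , busy-w) with lastBusyBelow S x
  ... | inj₁ idle = contradiction busy-w (idle⇒¬busy S (idle w<x))
  ... | inj₂ (v , v<x , busy-v , idle-vx) = v , bounds , v<x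
    where
    bounds : GapBounds S v _
    bounds = record { nonempty = ≤-<-trans v<x x<t ; idle = idleBetween-join {S = S} idle-vx idle-x idle-xt
                    ; busy-start = busy-v ; busy-end = busy-t }

  window⇒gapCharged : ∀ {v t x} → GapBounds S v t → x < t → suc v ≤ x × x < suc v + L → GapCharged x t
  window⇒gapCharged {v} g x<t (v<x , x<1+v+L) =
    idle x<t v<x , busy-end , (λ y<t x<y → idle y<t (<-trans v<x x<y)) , v , v<x , s≤s⁻¹ x<1+v+L , busy-start
    where open GapBounds g

  gapCharged⇒window : ∀ {v t x} → GapBounds S v t → x < t → GapCharged x t → suc v ≤ x × x < suc v + L
  gapCharged⇒window {v} {t} {x} g x<t (idle-x , _ , idle-xt , w , w<x , x≤w+L , busy-w) with <-cmp v x
  ... | tri≈ _ refl _ = contradiction busy-start (idle⇒¬busy S idle-x)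
    where open GapBounds g
  ... | tri> _ _ x<v  = contradiction busy-start (idle⇒¬busy S (idle-xt (<-trans (n<1+n v) nonempty) x<v))
    where open GapBounds g
  ... | tri< v<x _ _  = v<x , s≤s (≤-trans x≤w+L (+-monoˡ-≤ L w≤v))
    where
    open GapBounds g
    w≤v : w ≤ v
    w≤v = ≮⇒≥ λ v<w → contradiction busy-w (idle⇒¬busy S (idle (<-trans w<x x<t) v<w))

  gapEnergy : ℕ → ℕ → ℕ
  gapEnergy t u = if gapB S u t then (t ∸ u) ⊓ L else 0

  gapEnergy-gap : ∀ u t → gapB S u t ≡ true → gapEnergy t u ≡ (t ∸ u) ⊓ L
  gapEnergy-gap u t = cong (λ b → if b then (t ∸ u) ⊓ L else 0)

  gapEnergy-no-gap : ∀ u t → gapB S u t ≢ true → gapEnergy t u ≡ 0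
  gapEnergy-no-gap u t ¬gap = cong (λ b → if b then (t ∸ u) ⊓ L else 0) (¬-not ¬gap)

  gapEnergy-as-count-of-gap : ∀ {v t} → GapBounds S v t →
    sumBelow t (gapEnergy t) ≡ sumBelow t (λ x → indicator (gapCharged? x t))
  gapEnergy-as-count-of-gap {v} {t} g = begin
    sumBelow t (gapEnergy t)              ≡⟨ sumBelow-single t (gapEnergy t) nonempty other-zero ⟩
    gapEnergy t (suc v)                   ≡⟨ gapEnergy-gap (suc v) t (bounds⇒gap g) ⟩
    (t ∸ suc v) ⊓ L                     ≡⟨ cong ((t ∸ suc v) ⊓_) (m+n∸m≡n (suc v) L) ⟨
    (t ∸ suc v) ⊓ (suc v + L ∸ suc v)   ≡⟨ ∸-distribʳ-⊓ (suc v) t (suc v + L) ⟨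
    t ⊓ (suc v + L) ∸ suc v             ≡⟨ sumBelow-interval t (suc v) (suc v + L) ⟨
    sumBelow t (λ x → indicator ((suc v ≤? x) ×-dec (x <? suc v + L)))
      ≡⟨ sumBelow-cong t (λ x<t → indicator-cong (window⇒gapCharged g x<t) (gapCharged⇒window g x<t) _ _) ⟩
    sumBelow t (λ x → indicator (gapCharged? x t)) ∎
    where
    open ≡-Reasoning
    open GapBounds g
    other-zero : ∀ {u} → u < t → u ≢ suc v → gapEnergy t u ≡ 0
    other-zero {u} _ u≢1+v = gapEnergy-no-gap u t λ gap →
      let (v' , u≡1+v' , g') = gap⇒bounds gap in u≢1+v (trans u≡1+v' (cong suc (gap-unique g' g)))

  gapEnergy-as-count : ∀ t → sumBelow t (gapEnergy t) ≡ sumBelow t (λ x → indicator (gapCharged? x t))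
  gapEnergy-as-count t with anyUpTo? (λ u → gapB S u t ≟ᵇ true) t
  ... | yes (u , _ , gap) with gap⇒bounds {u = u} gap
  ...   | _ , refl , g = gapEnergy-as-count-of-gap g
  gapEnergy-as-count t | no ¬gap =
    trans (sumBelow-zero t λ {u} u<t → gapEnergy-no-gap u t λ gap → ¬gap (u , u<t , gap))
          (sym (sumBelow-zero t λ x<t → indicator-no (gapCharged? _ t) (no-gap x<t)))
    where
    no-gap : ∀ {x} → x < t → ¬ GapCharged x t
    no-gap x<t charged with gapCharged⇒gap x<t charged
    ... | v , g , _ = ¬gap (suc v , GapBounds.nonempty g , bounds⇒gap g)

  gapCharged-count : ∀ H x →
    sumBelow H (λ t → if ⌊ x <? t ⌋ then indicator (gapCharged? x t) else 0) ≡ indicator (charged? H x)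
  gapCharged-count H x with charged? H x
  ... | no ¬charged = sumBelow-zero H term-zero
    where
    term-zero : ∀ {t} → t < H → (if ⌊ x <? t ⌋ then indicator (gapCharged? x t) else 0) ≡ 0
    term-zero {t} t<H with x <? t
    ... | no _    = refl
    ... | yes x<t = indicator-no (gapCharged? x t) λ (idle-x , busy-t , _ , within) →
                      ¬charged (idle-x , within , t , t<H , x<t , busy-t)
  ... | yes (idle-x , within , y , y<H , x<y , busy-y) with firstBusyAbove S x H
  ...   | inj₁ idle = contradiction busy-y (idle⇒¬busy S (idle y<H x<y))
  ...   | inj₂ (t₀ , t₀<H , x<t₀ , busy-t₀ , idle-xt₀) = trans (sumBelow-single H _ t₀<H others) at-t₀
    where
    at-t₀ : (if ⌊ x <? t₀ ⌋ then indicator (gapCharged? x t₀) else 0) ≡ 1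
    at-t₀ rewrite ⌊⌋-true (x <? t₀) x<t₀ =
      indicator-yes (gapCharged? x t₀) (idle-x , busy-t₀ , idle-xt₀ , within)
    others : ∀ {t} → t < H → t ≢ t₀ → (if ⌊ x <? t ⌋ then indicator (gapCharged? x t) else 0) ≡ 0
    others {t} _ t≢t₀ with x <? t
    ... | no _    = refl
    ... | yes x<t = indicator-no (gapCharged? x t) λ (_ , busy-t , idle-xt , _) →
      case <-cmp t t₀ of λ where
      (tri< t<t₀ _ _) → idle⇒¬busy S (idle-xt₀ t<t₀ x<t) busy-t
      (tri≈ _ t≡t₀ _) → t≢t₀ t≡t₀
      (tri> _ _ t₀<t) → idle⇒¬busy S (idle-xt t₀<t x<t₀) busy-t₀

energy-as-count : ∀ (I : Instance n) S →
  energy I S ≡ sumBelow (horizon I) (λ x → indicator (charged? S (L I) (horizon I) x))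
energy-as-count I S = begin
  energy I S
    ≡⟨ sumBelow-cong H (λ {t} _ → gapEnergy-as-count S (L I) t) ⟩
  sumBelow H (λ t → sumBelow t (λ x → indicator (gapCharged? S (L I) x t)))
    ≡⟨ sumBelow-triangle H (λ x t → indicator (gapCharged? S (L I) x t)) ⟩
  sumBelow H (λ x → sumBelow H (λ t → if ⌊ x <? t ⌋ then indicator (gapCharged? S (L I) x t) else 0))
    ≡⟨ sumBelow-cong H (λ {x} _ → gapCharged-count S (L I) H x) ⟩
  sumBelow H (λ x → indicator (charged? S (L I) H x)) ∎
  where
  open ≡-Reasoning
  H = horizon I

slotWork : Schedule n → Fin n → ℕ → ℕ
slotWork S j t = if runs S t j then 1 else 0

work-cong : ∀ (S S' : Schedule n) j D → (∀ {x} → x < D → runs S x j ≡ runs S' x j) →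
            work S j D ≡ work S' j D
work-cong S S' j D same = sumBelow-cong D λ x<D → cong (λ b → if b then 1 else 0) (same x<D)

work-mono : ∀ (S : Schedule n) j {a b} → a ≤ b → work S j a ≤ work S j b
work-mono S j {b = zero}  z≤n = ≤-refl
work-mono S j {b = suc b} a≤1+b with m≤n⇒m<n∨m≡n a≤1+b
... | inj₂ refl = ≤-refl
... | inj₁ a<1+b = ≤-trans (work-mono S j (s≤s⁻¹ a<1+b)) (m≤m+n _ _)

work-suc : ∀ (S : Schedule n) {j x} → runs S x j ≡ true → work S j (suc x) ≡ suc (work S j x)
work-suc S {j} {x} run rewrite run = +-comm (work S j x) 1

work-< : ∀ (S : Schedule n) {j a x D} → runs S x j ≡ true → a ≤ x → x < D → work S j a < work S j D
work-< S {j} {a} {x} {D} run a≤x x<D = begin-strict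
  work S j a       ≤⟨ work-mono S j a≤x ⟩
  work S j x       <⟨ n<1+n (work S j x) ⟩
  suc (work S j x) ≡⟨ work-suc S run ⟨
  work S j (suc x) ≤⟨ work-mono S j x<D ⟩
  work S j D       ∎
  where open ≤-Reasoning

work-find : ∀ (S : Schedule n) j a D → work S j a < work S j D →
            ∃ λ x → a ≤ x × x < D × runs S x j ≡ true
work-find S j a zero lt = contradiction lt n≮0
work-find S j a (suc D) lt with a ≤? D
... | no a≰D = contradiction lt (≤⇒≯ (work-mono S j (≰⇒> a≰D)))
... | yes a≤D with runs S D j in run
...   | true  = D , a≤D , ≤-refl , run
...   | false with work-find S j a D (subst (work S j a <_) (+-identityʳ _) lt)
...     | x , a≤x , x<D , run-x = x , a≤x , m≤n⇒m≤1+n x<D , run-x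

maxBelow-attained : ∀ k (g : ℕ → ℕ) {m} → 0 < m → m ≤ maxBelow k g → ∃ λ x → x < k × m ≤ g x
maxBelow-attained zero    g 0<m m≤0 = contradiction m≤0 (<⇒≱ 0<m)
maxBelow-attained (suc k) g 0<m m≤max with ⊔-sel (maxBelow k g) (g k)
... | inj₂ max≡gk = k , ≤-refl , ≤-trans m≤max (≤-reflexive max≡gk)
... | inj₁ max≡rest with maxBelow-attained k g 0<m (≤-trans m≤max (≤-reflexive max≡rest))
...   | x , x<k , m≤gx = x , m≤n⇒m≤1+n x<k , m≤gx

completion⇒runs : ∀ (I : Instance n) S j {t} → 0 < t → t ≤ completion I S j →
                  ∃ λ x → runs S x j ≡ true × t ≤ suc x
completion⇒runs I S j 0<t t≤C
  with maxBelow-attained (horizon I) (λ x → if runs S x j then suc x else 0) 0<t t≤C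
... | x , _ , t≤ with runs S x j in run
...   | true  = x , run , t≤
...   | false = contradiction t≤ (<⇒≱ 0<t)

maxJobs-≥ : ∀ (f : Fin n → ℕ) j → f j ≤ maxJobs f
maxJobs-≥ f Fin.zero    = m≤m⊔n _ _
maxJobs-≥ f (Fin.suc j) = ≤-trans (maxJobs-≥ (f ∘ Fin.suc) j) (m≤n⊔m _ _)

d≤horizon : ∀ (I : Instance n) j → d I j ≤ horizon I
d≤horizon I = maxJobs-≥ (d I)

IdleFrom : ℕ → Schedule n → Set
IdleFrom k S = ∀ {t} → k ≤ t → S t ≡ nothing

feasible⇒idleFrom : ∀ (I : Instance n) S → Feasible I S → IdleFrom (horizon I) S
feasible⇒idleFrom I S (in-window , _) {t} H≤t with S t in eq
... | nothing = refl
... | just j  =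
  contradiction H≤t (<⇒≱ (<-≤-trans (proj₂ (in-window j t (just⇒runs S eq))) (d≤horizon I j)))

Pending : Instance n → Schedule n → ℕ → Fin n → Set
Pending I S a k = r I k ≤ a × work S k a < p I k

pending? : ∀ (I : Instance n) S a → Decidable (Pending I S a)
pending? I S a k = (r I k ≤? a) ×-dec (work S k a <? p I k)

pending-before-completion : ∀ (I : Instance n) S {j a} → Feasible I S → r I j ≤ a → suc a ≤ completion I S j →
                            Pending I S a j
pending-before-completion I S {j} {a} (in-window , complete) r≤a a<C
  with completion⇒runs I S j z<s a<C
... | x , run , a<1+x =
  r≤a , subst (work S j a <_) (complete j) (work-< S run (s≤s⁻¹ a<1+x) (proj₂ (in-window j x run)))

-- Moving a busy slot to an earlier idle slot

record BusyShift (S S' : Schedule n) (a s : ℕ) : Set where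
  field
    a<s       : a < s
    idle-a    : Idle S a
    busy-a    : Busy S' a
    busy-s    : Busy S s
    idle-s    : Idle S' s
    unchanged : ∀ {x} → x ≢ a → x ≢ s → busy S' x ≡ busy S x

busySlotSum : ℕ → Schedule n → ℕ
busySlotSum H S = sumBelow H (λ x → if busy S x then x else 0)

module _ {S S' : Schedule n} {a s : ℕ} (shift : BusyShift S S' a s) where
  open BusyShift shift

  charged-shift : ∀ {L H x} → s < H → Busy S (suc a) → x ≢ a → x ≢ s →
                  Charged S' L H x → Charged S L H x
  charged-shift {L} {H} {x} s<H busy-1+a x≢a x≢s
                (idle-x' , (y , y<x , x≤y+L , busy-y') , (z , z<H , x<z , busy-z')) =
    idle-x , within , later
    where
    idle-x : Idle S x
    idle-x = trans (sym (unchanged x≢a x≢s)) idle-x'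
    within : BusyWithin S L x
    within with y ≟ a | y ≟ s
    ... | yes refl | _     = suc a , ≤∧≢⇒< y<x 1+a≢x , ≤-trans x≤y+L (+-monoˡ-≤ L (n≤1+n a)) , busy-1+a
      where
      1+a≢x : suc a ≢ x
      1+a≢x 1+a≡x = idle⇒¬busy S idle-x (subst (Busy S) 1+a≡x busy-1+a)
    ... | no _ | yes refl   = contradiction busy-y' (idle⇒¬busy S' idle-s)
    ... | no y≢a | no y≢s  = y , y<x , x≤y+L , trans (sym (unchanged y≢a y≢s)) busy-y'
    later : ∃ λ z → z < H × (x < z × Busy S z)
    later with z ≟ a | z ≟ s
    ... | yes refl | _     = s , s<H , <-trans x<z a<s , busy-s
    ... | no _ | yes refl   = contradiction busy-z' (idle⇒¬busy S' idle-s)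
    ... | no z≢a | no z≢s  = z , z<H , x<z , trans (sym (unchanged z≢a z≢s)) busy-z'

  -- Apart from s, every slot charged in S' is charged in S; and a is charged in S but busy in S'.
  energy-shift : ∀ (I : Instance n) → s < horizon I → Busy S (suc a) → BusyWithin S (L I) a →
                 energy I S' ≤ energy I S
  energy-shift I s<H busy-1+a within-a = begin
    energy I S'
      ≡⟨ energy-as-count I S' ⟩
    sumBelow H (λ x → indicator (charged? S' ℓ H x))
      ≤⟨ +-cancelʳ-≤ 1 _ _ (sumBelow-exchange H (<-trans a<s s<H) s<H pointwise) ⟩
    sumBelow H (λ x → indicator (charged? S ℓ H x))
      ≡⟨ energy-as-count I S ⟨
    energy I S ∎
    where
    open ≤-Reasoning
    H = horizon I
    ℓ = L I
    charged-a : Charged S ℓ H a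
    charged-a = idle-a , within-a , suc a , ≤-<-trans a<s s<H , ≤-refl , busy-1+a
    pointwise : ∀ {x} → x < H →
                indicator (charged? S' ℓ H x) + δ a 1 x ≤ indicator (charged? S ℓ H x) + δ s 1 x
    pointwise {x} _ with x ≟ a
    ... | yes refl
      rewrite indicator-no (charged? S' ℓ H x) (λ c → idle⇒¬busy S' (proj₁ c) busy-a)
            | indicator-yes (charged? S ℓ H x) charged-a | δ-off 1 (<⇒≢ a<s) = ≤-refl
    ... | no x≢a with x ≟ s
    ...   | yes refl =
      ≤-trans (≤-reflexive (+-identityʳ _)) (≤-trans (indicator-≤1 (charged? S' ℓ H x)) (m≤n+m 1 _))
    ...   | no x≢s   = +-monoˡ-≤ 0 (indicator-mono (charged-shift s<H busy-1+a x≢a x≢s) _ _)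

  busySlotSum-shift : ∀ {H} → s < H → busySlotSum H S' < busySlotSum H S
  busySlotSum-shift {H} s<H = +-cancelʳ-< s _ _ (begin-strict
    busySlotSum H S' + s ≤⟨ sumBelow-exchange H s<H (<-trans a<s s<H) pointwise ⟩
    busySlotSum H S + a <⟨ +-monoʳ-< (busySlotSum H S) a<s ⟩
    busySlotSum H S + s ∎)
    where
    open ≤-Reasoning
    pointwise : ∀ {x} → x < H →
                (if busy S' x then x else 0) + δ s s x ≤ (if busy S x then x else 0) + δ a a x
    pointwise {x} _ with x ≟ a
    ... | yes refl rewrite idle-a | busy-a | δ-off s (<⇒≢ a<s) = ≤-reflexive (+-comm x 0)
    ... | no x≢a with x ≟ s
    ...   | yes refl rewrite busy-s | idle-s = ≤-reflexive (+-comm 0 x)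
    ...   | no x≢s rewrite unchanged x≢a x≢s = ≤-refl

_[_≔_] : Schedule n → ℕ → Maybe (Fin n) → Schedule n
(S [ a ≔ m ]) x = if ⌊ x ≟ a ⌋ then m else S x

update-at : ∀ (S : Schedule n) a m → (S [ a ≔ m ]) a ≡ m
update-at S a m rewrite ⌊⌋-true (a ≟ a) refl = refl

update-off : ∀ (S : Schedule n) {a x} m → x ≢ a → (S [ a ≔ m ]) x ≡ S x
update-off S {a} {x} m x≢a rewrite ⌊⌋-false (x ≟ a) x≢a = refl

module Shift (S : Schedule n) {a s : ℕ} {k : Fin n} (a<s : a < s) (idle-a : Idle S a) (S-s : S s ≡ just k)
  where

  -- abstract, so that case splits on x ≟ a cannot reach inside the definition of shifted
  abstract
    shifted : Schedule n
    shifted = S [ s ≔ nothing ] [ a ≔ just k ]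

    shifted-a : shifted a ≡ just k
    shifted-a = update-at (S [ s ≔ nothing ]) a (just k)

    shifted-s : shifted s ≡ nothing
    shifted-s = trans (update-off (S [ s ≔ nothing ]) (just k) (≢-sym (<⇒≢ a<s))) (update-at S s nothing)

    shifted-other : ∀ {x} → x ≢ a → x ≢ s → shifted x ≡ S x
    shifted-other x≢a x≢s = trans (update-off (S [ s ≔ nothing ]) (just k) x≢a) (update-off S nothing x≢s)

  busyShift : BusyShift S shifted a s
  busyShift = record
    { a<s = a<s ; idle-a = idle-a ; busy-a = just⇒busy shifted shifted-a
    ; busy-s = just⇒busy S S-s ; idle-s = nothing⇒idle shifted shifted-s
    ; unchanged = λ x≢a x≢s → busy-cong shifted S (shifted-other x≢a x≢s) }

  runs-other : ∀ {j x} → x ≢ a → x ≢ s → runs shifted x j ≡ runs S x j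
  runs-other x≢a x≢s = runs-cong shifted S (shifted-other x≢a x≢s)

  runs-≢k : ∀ {j} → j ≢ k → ∀ x → runs shifted x j ≡ runs S x j
  runs-≢k {j} j≢k x with x ≟ a | x ≟ s
  ... | yes refl | _ = trans (just⇒¬runs shifted shifted-a (≢-sym j≢k)) (sym (idle⇒¬runs S idle-a))
  ... | no _ | yes refl = trans (nothing⇒¬runs shifted shifted-s) (sym (just⇒¬runs S S-s (≢-sym j≢k)))
  ... | no x≢a | no x≢s = runs-other x≢a x≢s

  work-k-after : ∀ {D} → s < D → work shifted k D ≡ work S k D
  work-k-after {D} s<D = ≤-antisym
    (+-cancelʳ-≤ 1 _ _ (sumBelow-exchange D s<D a<D λ x<D → ≤-reflexive (pointwise x<D)))
    (+-cancelʳ-≤ 1 _ _ (sumBelow-exchange D a<D s<D λ x<D → ≤-reflexive (sym (pointwise x<D))))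
    where
    a<D = <-trans a<s s<D
    pointwise : ∀ {x} → x < D → slotWork shifted k x + δ s 1 x ≡ slotWork S k x + δ a 1 x
    pointwise {x} _ with x ≟ a
    ... | yes refl rewrite just⇒runs shifted shifted-a | idle⇒¬runs S {j = k} idle-a
                         | δ-off 1 (<⇒≢ a<s) = refl
    ... | no x≢a with x ≟ s
    ...   | yes refl rewrite nothing⇒¬runs shifted {j = k} shifted-s | just⇒runs S S-s = refl
    ...   | no x≢s rewrite runs-other {k} x≢a x≢s = refl

  work-≤ : ∀ j D → work S j D ≤ work shifted j D
  work-≤ j D with j ≟ᶠ k | s <? D
  ... | no j≢k   | _       = ≤-reflexive (work-cong S shifted j D λ {x} _ → sym (runs-≢k j≢k x))
  ... | yes refl | yes s<D = ≤-reflexive (sym (work-k-after s<D))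
  ... | yes refl | no s≮D  = sumBelow-mono D pointwise
    where
    pointwise : ∀ {x} → x < D → slotWork S k x ≤ slotWork shifted k x
    pointwise {x} x<D with x ≟ a
    ... | yes refl rewrite idle⇒¬runs S {j = k} idle-a = z≤n
    ... | no x≢a = ≤-reflexive (cong (λ b → if b then 1 else 0)
                     (sym (runs-other x≢a λ x≡s → s≮D (subst (_< D) x≡s x<D))))

  work-at-a : ∀ j → work shifted j a ≡ work S j a
  work-at-a j = work-cong shifted S j a λ x<a → runs-other (<⇒≢ x<a) (<⇒≢ (<-trans x<a a<s))

  shifted-feasible : ∀ (I : Instance n) → Feasible I S → r I k ≤ a → Feasible I shifted
  shifted-feasible I (in-window , complete) r≤a = in-window' , complete'
    where
    s<d : s < d I k
    s<d = proj₂ (in-window k s (just⇒runs S S-s))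
    in-window' : ∀ j t → runs shifted t j ≡ true → r I j ≤ t × t < d I j
    in-window' j t run with t ≟ a | t ≟ s
    ... | yes refl | _ with just-injective (trans (sym shifted-a) (runs⇒just shifted run))
    ...   | refl = r≤a , <-trans a<s s<d
    in-window' j t run | no _ | yes refl =
      ⊥-elim (false≢true (trans (sym (nothing⇒¬runs shifted shifted-s)) run))
    in-window' j t run | no t≢a | no t≢s = in-window j t (trans (sym (runs-other t≢a t≢s)) run)
    complete' : ∀ j → work shifted j (d I j) ≡ p I j
    complete' j with j ≟ᶠ k
    ... | yes refl = trans (work-k-after s<d) (complete j)
    ... | no j≢k   = trans (work-cong shifted S j (d I j) λ {x} _ → runs-≢k j≢k x) (complete j)

  shifted-EDF : ∀ (I : Instance n) → EDF I S → (∀ {k'} → Pending I S a k' → d I k ≤ d I k') →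
                EDF I shifted
  shifted-EDF I edf k-first t j k' runs-j r≤t unfinished with t ≟ a | t ≟ s
  ... | yes refl | _ with just-injective (trans (sym shifted-a) runs-j)
  ...   | refl = k-first (r≤t , subst (_< p I k') (work-at-a k') unfinished)
  shifted-EDF I edf k-first t j k' runs-j r≤t unfinished | no _ | yes refl
    with () ← trans (sym shifted-s) runs-j
  shifted-EDF I edf k-first t j k' runs-j r≤t unfinished | no t≢a | no t≢s =
    edf t j k' (trans (sym (shifted-other t≢a t≢s)) runs-j) r≤t (≤-<-trans (work-≤ k' t) unfinished)

minimal : ∀ {P : A → Set} → Decidable P → (f : A → ℕ) (xs : List A) {x₀ : A} → P x₀ →
          ∃ λ x → P x × ∀ {y} → y ∈ xs → P y → f x ≤ f y
minimal P? f xs {x₀} Px₀ =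
  argmin f x₀ (filter P? xs) ,
  argmin-all f Px₀ (all-filter P? xs) ,
  λ y∈xs Py → lookup (f[argmin]≤f[xs] {f = f} x₀ (filter P? xs)) (∈-filter⁺ P? y∈xs Py)

record LexMinimum {A : Set} (P : A → Set) (f g : A → ℕ) (xs : List A) : Set where
  field
    point   : A
    holds   : P point
    f-least : ∀ {y} → y ∈ xs → P y → f point ≤ f y
    g-least : ∀ {y} → y ∈ xs → P y → f y ≤ f point → g point ≤ g y

lexMinimal : ∀ {P : A → Set} → Decidable P → (f g : A → ℕ) (xs : List A) {x₀ : A} → P x₀ →
             LexMinimum P f g xs
lexMinimal P? f g xs Px₀ with minimal P? f xs Px₀
... | x₁ , Px₁ , x₁-least with minimal (λ y → P? y ×-dec (f y ≟ f x₁)) g xs (Px₁ , refl)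
...   | x₂ , (Px₂ , fx₂≡fx₁) , x₂-least = record
  { point   = x₂
  ; holds   = Px₂
  ; f-least = λ y∈xs Py → ≤-trans (≤-reflexive fx₂≡fx₁) (x₁-least y∈xs Py)
  ; g-least = λ y∈xs Py fy≤fx₂ →
      x₂-least y∈xs (Py , ≤-antisym (≤-trans fy≤fx₂ (≤-reflexive fx₂≡fx₁)) (x₁-least y∈xs Py))
  }

-- Existence of a lexicographically optimal schedule

_◁_ : Maybe (Fin n) → Schedule n → Schedule n
(m ◁ S) zero    = m
(m ◁ S) (suc t) = S t

BoundedSchedule : ℕ → ℕ → Set
BoundedSchedule n k = Σ (Schedule n) (IdleFrom k)

prepend : ∀ {k} → Maybe (Fin n) → BoundedSchedule n k → BoundedSchedule n (suc k)
prepend m (S , idle) = m ◁ S , λ { {zero} () ; {suc t} (s≤s k≤t) → idle k≤t }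

slotContents : List (Maybe (Fin n))
slotContents = nothing ∷ map just (allFin _)

∈-slotContents : ∀ (m : Maybe (Fin n)) → m ∈ slotContents
∈-slotContents nothing  = here refl
∈-slotContents (just j) = there (∈-map⁺ just (∈-allFin j))

boundedSchedules : ∀ n k → List (BoundedSchedule n k)
boundedSchedules n zero    = ((λ _ → nothing) , λ _ → refl) ∷ []
boundedSchedules n (suc k) = concatMap (λ m → map (prepend m) (boundedSchedules n k)) slotContents

boundedSchedules-complete : ∀ k {S : Schedule n} → IdleFrom k S →
                            ∃ λ X → X ∈ boundedSchedules n k × proj₁ X ≗ S
boundedSchedules-complete zero idle = _ , here refl , λ _ → sym (idle z≤n)
boundedSchedules-complete (suc k) {S} idle
  with boundedSchedules-complete k {S ∘ suc} (λ k≤t → idle (s≤s k≤t))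
... | X , X∈ , X≗ =
  prepend (S 0) X ,
  ∈-concatMap⁺ (λ m → map (prepend m) (boundedSchedules _ k))
               (lose (∈-slotContents (S 0)) (∈-map⁺ (prepend (S 0)) X∈)) ,
  λ { zero → refl ; (suc t) → X≗ t }

module _ {S S' : Schedule n} (S≗S' : S ≗ S') where

  idleRun-≗ : ∀ u m → idleRun S u m ≡ idleRun S' u m
  idleRun-≗ u zero    = refl
  idleRun-≗ u (suc m) = cong₂ (λ b rest → if b then false else rest)
                              (busy-cong S S' (S≗S' u)) (idleRun-≗ (suc u) m)

  gapB-≗ : ∀ u t → gapB S u t ≡ gapB S' u t
  gapB-≗ zero    t = refl
  gapB-≗ (suc v) t rewrite idleRun-≗ (suc v) (t ∸ suc v)
                         | busy-cong S S' (S≗S' v) | busy-cong S S' (S≗S' t) = refl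

  energy-≗ : ∀ (I : Instance n) → energy I S ≡ energy I S'
  energy-≗ I = sumBelow-cong (horizon I) λ {t} _ → sumBelow-cong t λ {u} _ →
    cong (λ b → if b then (t ∸ u) ⊓ L I else 0) (gapB-≗ u t)

  busySlotSum-≗ : ∀ H → busySlotSum H S ≡ busySlotSum H S'
  busySlotSum-≗ H = sumBelow-cong H λ {x} _ →
    cong (λ b → if b then x else 0) (busy-cong S S' (S≗S' x))

  work-≗ : ∀ j D → work S j D ≡ work S' j D
  work-≗ j D = work-cong S S' j D λ {x} _ → runs-cong S S' (S≗S' x)

  feasible-≗ : ∀ (I : Instance n) → Feasible I S → Feasible I S'
  feasible-≗ I (in-window , complete) =
    (λ j t run → in-window j t (trans (runs-cong S S' (S≗S' t)) run)) ,
    (λ j → trans (sym (work-≗ j (d I j))) (complete j))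

  EDF-≗ : ∀ (I : Instance n) → EDF I S → EDF I S'
  EDF-≗ I edf t j k runs-j r≤t unfinished =
    edf t j k (trans (S≗S' t) runs-j) r≤t (subst (_< p I k) (sym (work-≗ k t)) unfinished)

module _ (I : Instance n) {S : Schedule n} (idle : IdleFrom (horizon I) S) where

  private
    H = horizon I

    beyond-horizon : ∀ {t} → ¬ t < H → S t ≡ nothing
    beyond-horizon t≮H = idle (≮⇒≥ t≮H)

  feasible? : Dec (Feasible I S)
  feasible? =
    map′ unbound (λ h j _ → h j _)
      (all? λ j → allUpTo? (λ t → (runs S t j ≟ᵇ true) →-dec ((r I j ≤? t) ×-dec (t <? d I j))) H)
    ×-dec all? (λ j → work S j (d I j) ≟ p I j)
    where
    unbound : (∀ j {t} → t < H → runs S t j ≡ true → r I j ≤ t × t < d I j) →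
              ∀ j t → runs S t j ≡ true → r I j ≤ t × t < d I j
    unbound bounded j t run with t <? H
    ... | yes t<H = bounded j t<H run
    ... | no t≮H  = ⊥-elim (false≢true (trans (sym (nothing⇒¬runs S (beyond-horizon t≮H))) run))

  EDF? : Dec (EDF I S)
  EDF? = map′ unbound (λ h {t} _ → h t)
    (allUpTo? (λ t → all? λ j → all? λ k →
      ≡-dec _≟ᶠ_ (S t) (just j) →-dec
        ((r I k ≤? t) →-dec ((work S k t <? p I k) →-dec (d I j ≤? d I k)))) H)
    where
    unbound : (∀ {t} → t < H → ∀ j k → S t ≡ just j → r I k ≤ t → work S k t < p I k → d I j ≤ d I k) →
              EDF I S
    unbound bounded t j k runs-j with t <? H
    ... | yes t<H = bounded t<H j k runs-j
    ... | no t≮H with () ← trans (sym runs-j) (beyond-horizon t≮H)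

LeastBusySlotSum : Instance n → Schedule n → Set
LeastBusySlotSum I S = ∀ S' → Feasible I S' → EDF I S' → energy I S' ≤ energy I S →
                       busySlotSum (horizon I) S ≤ busySlotSum (horizon I) S'

lexOptimal-exists : ∀ (I : Instance n) → (∃ λ S → Feasible I S × EDF I S) →
                    ∃ λ S → Optimal I S × LeastBusySlotSum I S
lexOptimal-exists {n} I (S₀ , feasible₀ , edf₀) = proj₁ point , (feasible , edf , optimal) , least
  where
  H = horizon I

  Admissible : BoundedSchedule n H → Set
  Admissible (S , _) = Feasible I S × EDF I S

  admissible? : Decidable Admissible
  admissible? (S , idle) = feasible? I {S} idle ×-dec EDF? I {S} idle

  open LexMinimum (lexMinimal admissible? (energy I ∘ proj₁) (busySlotSum H ∘ proj₁) (boundedSchedules n H)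
                               {S₀ , feasible⇒idleFrom I S₀ feasible₀} (feasible₀ , edf₀))

  feasible = proj₁ holds
  edf      = proj₂ holds

  represent : ∀ {S} → Feasible I S → EDF I S →
              ∃ λ X → X ∈ boundedSchedules n H × Admissible X × proj₁ X ≗ S
  represent {S} feasible-S edf-S with boundedSchedules-complete H (feasible⇒idleFrom I S feasible-S)
  ... | X , X∈ , X≗S =
    X , X∈ , (feasible-≗ (λ t → sym (X≗S t)) I feasible-S , EDF-≗ (λ t → sym (X≗S t)) I edf-S) , X≗S

  optimal : ∀ S → Feasible I S → EDF I S → energy I (proj₁ point) ≤ energy I S
  optimal S feasible-S edf-S with represent feasible-S edf-S
  ... | X , X∈ , admissible , X≗S = ≤-trans (f-least X∈ admissible) (≤-reflexive (energy-≗ X≗S I))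

  least : LeastBusySlotSum I (proj₁ point)
  least S feasible-S edf-S E≤ with represent feasible-S edf-S
  ... | X , X∈ , admissible , X≗S =
    ≤-trans (g-least X∈ admissible (≤-trans (≤-reflexive (energy-≗ X≗S I)) E≤))
            (≤-reflexive (busySlotSum-≗ X≗S H))

-- The exchange argument

module _ (I : Instance n) {S : Schedule n} (feasible : Feasible I S) (edf : EDF I S)
         (least : LeastBusySlotSum I S) where

  no-pending-at-small-gap-end : ∀ {v a} → GapBounds S v (suc a) → a ≤ v + L I → ¬ Pending I S a j
  no-pending-at-small-gap-end {v = v} {a} g a≤v+L pending-j
    with minimal (pending? I S a) (d I) (allFin _) pending-j
  ... | k , (r≤a , unfinished) , k-first
    with work-find S k a (d I k) (subst (work S k a <_) (sym (proj₂ feasible k)) unfinished)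
  ... | s , a≤s , s<d , runs-k =
    <⇒≱ (busySlotSum-shift busyShift s<H)
        (least shifted (shifted-feasible I feasible r≤a) (shifted-EDF I edf (k-first (∈-allFin _)))
               (energy-shift busyShift I s<H busy-end (v , v<a , a≤v+L , busy-start)))
    where
    open GapBounds g
    v<a : v < a
    v<a = s≤s⁻¹ nonempty
    idle-a : Idle S a
    idle-a = idle ≤-refl v<a
    a<s : a < s
    a<s = ≤∧≢⇒< a≤s λ a≡s → idle⇒¬busy S idle-a (subst (Busy S) (sym a≡s) (runs⇒busy S runs-k))
    s<H : s < horizon I
    s<H = <-≤-trans s<d (d≤horizon I k)
    open Shift S a<s idle-a (runs⇒just S runs-k)

  small-gap-property : ∀ u t (j : Fin n) → SmallGap I S u t → t ≤ completion I S j → t ≤ r I j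
  small-gap-property zero    t       j (() , _)
  small-gap-property (suc v) zero    j (() , _)
  small-gap-property (suc v) (suc a) j (gap , small) t≤C with suc a ≤? r I j
  ... | yes t≤r = t≤r
  ... | no t≰r with gap⇒bounds {u = suc v} (Equivalence.to T-≡ gap)
  ...   | _ , refl , g =
    contradiction (pending-before-completion I S feasible (s≤s⁻¹ (≰⇒> t≰r)) t≤C)
                  (no-pending-at-small-gap-end g (≤-trans (m≤n+m∸n a v) (+-monoʳ-≤ v small)))

lemma12 : ∀ {n} (I : Instance n) →
    0 < L I →
    (∀ j → 0 < p I j) →
    (∀ i j → d I i ≡ d I j → i ≡ j) →
    (∀ i j → r I i ≡ r I j → i ≡ j) →
    (∃ λ (S : Schedule n) → Feasible I S × EDF I S) →
    ∃ λ (S : Schedule n) → Optimal I S ×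
    (∀ u t (j : Fin n) → SmallGap I S u t → t ≤ completion I S j → t ≤ r I j)
lemma12 I _ _ _ _ admissible with lexOptimal-exists I admissible
... | S , optimal@(feasible , edf , _) , least = S , optimal , small-gap-property I feasible edf least
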